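{- Let $\alpha_1,\beta_1,\gamma_1$ be arbitrary integers and set $\sigma=\alpha_1+\beta_1+\gamma_1$. (i) Every triple of dual numbers $(A,B,C)$ obtained from the initial triple $(A_1,B_1,C_1)=(1+\alpha_1\varepsilon,\,1+\beta_1\varepsilon,\,1+\gamma_1\varepsilon)$ by a finite sequence of permutations of the entries and of transformations $(A,B,C)\mapsto (A',B,C)$ with $A'=\frac{B^2+C^2}{A}$ satisfies $$A^2+B^2+C^2=(3-\sigma\varepsilon)ABC.$$ (ii) Conversely, every triple $(A,B,C)=(a+\alpha\varepsilon,\,b+\beta\varepsilon,\,c+\gamma\varepsilon)$ of dual numbers with integer components satisfying $A^2+B^2+C^2=(3-\sigma\varepsilon)ABC$ and with $a,b,c>0$ can be obtained from a triple of the form $(1+\alpha'\varepsilon,\,1+\beta'\varepsilon,\,1+\gamma'\varepsilon)$, with $\alpha',\beta',\gamma'$ integers, by a finite sequence of transformations $(A,B,C)\mapsto\left(\frac{B^2+C^2}{A},B,C\right)$ mixed with permutations of $A$, $B$, $C$.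
   Context: Dual numbers are formal expressions $a+\alpha\varepsilon$ with $\varepsilon^2=0$, forming a commutative ring; $a$ is the real part and $\alpha$ the nilpotent part. For $a\neq0$, division is given by $(b+\beta\varepsilon)/(a+\alpha\varepsilon)=\frac{b}{a}+\frac{\beta a-\alpha b}{a^2}\varepsilon$. -}

module Defs where

open import Data.Integer as ℤ using (ℤ)
open import Data.Rational as ℚ using (ℚ; 0ℚ; 1ℚ; _÷_; _/_)
open import Data.Product using (_×_; _,_)
open import Relation.Binary.PropositionalEquality using (_≡_; _≢_)

record Dual : Set where
  constructor _+_ε
  field
    re : ℚ
    im : ℚ
open Dual public

infixl 6 _⊕_
infixl 7 _⊗_

_⊕_ : Dual → Dual → Dual
(a + α ε) ⊕ (b + β ε) = (a ℚ.+ b) + (α ℚ.+ β) ε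

_⊗_ : Dual → Dual → Dual
(a + α ε) ⊗ (b + β ε) = (a ℚ.* b) + (a ℚ.* β ℚ.+ α ℚ.* b) ε

sq : Dual → Dual
sq x = x ⊗ x

ι : ℤ → ℚ
ι z = z / 1

dualℤ : ℤ → ℤ → Dual
dualℤ a α = ι a + ι α ε

divD : (B A : Dual) → .{{ℚ.NonZero (re A)}} → Dual
divD (b + β ε) (a + α ε) = (b ÷ a) + (((β ℚ.* a ℚ.- α ℚ.* b) ÷ a) ÷ a) ε

Triple : Set
Triple = Dual × Dual × Dual

MarkovEq : ℤ → Triple → Set
MarkovEq σ (A , B , C) =
  sq A ⊕ sq B ⊕ sq C ≡ (dualℤ (ℤ.+ 3) (ℤ.- σ) ⊗ A ⊗ B ⊗ C)

-- One elementary move: a transposition of entries (these generate all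
-- permutations of (A,B,C)), or the Vieta move (A,B,C) ↦ ((B²+C²)/A, B, C),
-- defined only when the real part of A is nonzero.
data Move : Triple → Triple → Set where
  swap₁₂ : ∀ A B C → Move (A , B , C) (B , A , C)
  swap₂₃ : ∀ A B C → Move (A , B , C) (A , C , B)
  vieta  : ∀ A B C → (nz : re A ≢ 0ℚ) →
           Move (A , B , C)
                (divD (sq B ⊕ sq C) A {{ℚ.≢-nonZero nz}} , B , C)

data Reach : Triple → Triple → Set where
  done : ∀ {T} → Reach T T
  step : ∀ {T U V} → Move T U → Reach U V → Reach T V

initial : ℤ → ℤ → ℤ → Triple
initial α β γ = dualℤ (ℤ.+ 1) α , dualℤ (ℤ.+ 1) β , dualℤ (ℤ.+ 1) γ

module Submission where

-- Viewed as a quadratic in A, the equation A² + B² + C² = K A B C with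
-- K = 3 - σε has the second root A′ = K B C - A = (B² + C²)/A, so every Vieta
-- move (and trivially every swap) preserves it: this is part (i).
-- For part (ii) the real parts (a, b, c) form a classical Markov triple. As in
-- Markov's descent, if a is the largest real part and a ≥ 2 then 0 < 3bc - a < a,
-- so replacing A by the integral dual number A′ lowers a + b + c. The descent
-- ends at real parts (1, 1, 1), an initial triple, and undoing it is a
-- sequence of Vieta moves and swaps.

open import Defs
import Data.Integer as ℤ
open ℤ using (ℤ)
open import Data.Product using (_×_; _,_; ∃-syntax)

open import Algebra.Bundles using (CommutativeRing)
import Algebra.Properties.CommutativeSemigroup as CommSemigroupProperties
import Algebra.Properties.Group as GroupProperties
open import Data.Empty using (⊥-elim)
import Data.Integer.Properties as ℤP
import Data.Integer.Tactic.RingSolver as ℤ-Solver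
open import Data.List.Base using ([]; _∷_)
open import Data.Maybe.Base using (nothing)
open import Data.Nat.Base using (ℕ; zero; suc; z≤n)
open import Data.Rational as ℚ using (0ℚ; 1ℚ; _÷_)
import Data.Rational.Properties as ℚP
open import Data.Rational.Unnormalised as ℚᵘ using (mkℚᵘ; *≡*)
import Data.Rational.Unnormalised.Properties as ℚᵘP
open import Data.Sum using (_⊎_; inj₁; inj₂)
open import Level using (0ℓ)
open import Relation.Binary.PropositionalEquality
  using (_≡_; _≢_; refl; sym; trans; cong; cong₂; subst; module ≡-Reasoning)
open import Algebra.Definitions {A = Dual} (_≡_)
open import Algebra.Structures {A = Dual} (_≡_) using (IsCommutativeRing)
open import Relation.Binary.PropositionalEquality.Algebra using (isMagma)
import Relation.Binary.Reasoning.Setoid as SetoidReasoning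
open import Relation.Nullary using (yes; no)
open import Relation.Nullary.Decidable.Core using (dec⇒maybe)
open import Tactic.RingSolver using (solve; solve-∀)
open import Tactic.RingSolver.Core.AlmostCommutativeRing
  using (AlmostCommutativeRing; fromCommutativeRing)

module MarkovEquation {c ℓ} (R : CommutativeRing c ℓ) where

  solverRing : AlmostCommutativeRing c ℓ
  solverRing = fromCommutativeRing R (λ _ → nothing)

  open AlmostCommutativeRing solverRing
  open GroupProperties (CommutativeRing.+-group R) using () renaming (∙-cancelʳ to +-cancelʳ)
  open SetoidReasoning setoid

  Markov : Carrier → Carrier → Carrier → Carrier → Set ℓ
  Markov k a b c = a * a + b * b + c * c ≈ k * a * b * c

  markov-swap₁₂ : ∀ k a b c → Markov k a b c → Markov k b a c
  markov-swap₁₂ k a b c m = begin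
    b * b + a * a + c * c ≈⟨ solve (a ∷ b ∷ c ∷ []) solverRing ⟩
    a * a + b * b + c * c ≈⟨ m ⟩
    k * a * b * c         ≈⟨ solve (k ∷ a ∷ b ∷ c ∷ []) solverRing ⟩
    k * b * a * c         ∎

  markov-swap₂₃ : ∀ k a b c → Markov k a b c → Markov k a c b
  markov-swap₂₃ k a b c m = begin
    a * a + c * c + b * b ≈⟨ solve (a ∷ b ∷ c ∷ []) solverRing ⟩
    a * a + b * b + c * c ≈⟨ m ⟩
    k * a * b * c         ≈⟨ solve (k ∷ a ∷ b ∷ c ∷ []) solverRing ⟩
    k * a * c * b         ∎

  -- Markov k a b c says that a is a root of x² - (kbc) x + (b² + c²); the
  -- lemmas below relate it to the other root a′ (Vieta's formulas). Additive
  -- cancellations are done by hand, since over an abstract ring the solver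
  -- cannot see that a coefficient 1# + - 1# vanishes.
  markov-otherRoot : ∀ k a a′ b c → a + a′ ≈ k * b * c →
                     Markov k a b c → Markov k a′ b c
  markov-otherRoot k a a′ b c s m = +-cancelʳ (a * (a + a′)) _ _ (begin
    a′ * a′ + b * b + c * c + a * (a + a′)  ≈⟨ solve (a ∷ a′ ∷ b ∷ c ∷ []) solverRing ⟩
    a′ * (a + a′) + (a * a + b * b + c * c) ≈⟨ +-cong (*-congˡ s) m ⟩
    a′ * (k * b * c) + k * a * b * c        ≈⟨ solve (k ∷ a ∷ a′ ∷ b ∷ c ∷ []) solverRing ⟩
    k * a′ * b * c + a * (k * b * c)        ≈⟨ +-congˡ (*-congˡ s) ⟨
    k * a′ * b * c + a * (a + a′)           ∎)

  markov-otherRoot-product : ∀ k a a′ b c → a + a′ ≈ k * b * c →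
                             Markov k a b c → a′ * a ≈ b * b + c * c
  markov-otherRoot-product k a a′ b c s m = +-cancelʳ (a * a) _ _ (begin
    a′ * a + a * a        ≈⟨ solve (a ∷ a′ ∷ []) solverRing ⟩
    a * (a + a′)          ≈⟨ *-congˡ s ⟩
    a * (k * b * c)       ≈⟨ solve (k ∷ a ∷ b ∷ c ∷ []) solverRing ⟩
    k * a * b * c         ≈⟨ m ⟨
    a * a + b * b + c * c ≈⟨ solve (a ∷ b ∷ c ∷ []) solverRing ⟩
    b * b + c * c + a * a ∎)

  markov-root-sum : ∀ k a a′ b c → a * a′ ≈ b * b + c * c →
                    Markov k a b c → a * (a + a′) ≈ a * (k * b * c)
  markov-root-sum k a a′ b c p m = begin
    a * (a + a′)            ≈⟨ solve (a ∷ a′ ∷ []) solverRing ⟩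
    a * a + a * a′          ≈⟨ +-congˡ p ⟩
    a * a + (b * b + c * c) ≈⟨ solve (a ∷ b ∷ c ∷ []) solverRing ⟩
    a * a + b * b + c * c   ≈⟨ m ⟩
    k * a * b * c           ≈⟨ solve (k ∷ a ∷ b ∷ c ∷ []) solverRing ⟩
    a * (k * b * c)         ∎

  *-cancelˡ-invertible : ∀ {a a⁻¹ x y} → a * a⁻¹ ≈ 1# → a * x ≈ a * y → x ≈ y
  *-cancelˡ-invertible {a} {a⁻¹} {x} {y} inv e = begin
    x             ≈⟨ *-identityˡ x ⟨
    1# * x        ≈⟨ *-congʳ inv ⟨
    a * a⁻¹ * x   ≈⟨ solve (a ∷ a⁻¹ ∷ x ∷ []) solverRing ⟩
    a⁻¹ * (a * x) ≈⟨ *-congˡ e ⟩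
    a⁻¹ * (a * y) ≈⟨ solve (a ∷ a⁻¹ ∷ y ∷ []) solverRing ⟩
    a * a⁻¹ * y   ≈⟨ *-congʳ inv ⟩
    1# * y        ≈⟨ *-identityˡ y ⟩
    y             ∎

ℚ-solverRing : AlmostCommutativeRing 0ℓ 0ℓ
ℚ-solverRing = fromCommutativeRing ℚP.+-*-commutativeRing λ x → dec⇒maybe (0ℚ ℚP.≟ x)

q*[p÷q]≡p : ∀ p q .{{_ : ℚ.NonZero q}} → q ℚ.* (p ÷ q) ≡ p
q*[p÷q]≡p p q = begin
  q ℚ.* (p ℚ.* ℚ.1/ q) ≡⟨ ℚP.*-assoc q p _ ⟨
  q ℚ.* p ℚ.* ℚ.1/ q   ≡⟨ cong (ℚ._* ℚ.1/ q) (ℚP.*-comm q p) ⟩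
  p ℚ.* q ℚ.* ℚ.1/ q   ≡⟨ ℚP.*-assoc p q _ ⟩
  p ℚ.* (q ℚ.* ℚ.1/ q) ≡⟨ cong (p ℚ.*_) (ℚP.*-inverseʳ q) ⟩
  p ℚ.* 1ℚ             ≡⟨ ℚP.*-identityʳ p ⟩
  p                    ∎
  where open ≡-Reasoning

0ᴰ 1ᴰ : Dual
0ᴰ = 0ℚ + 0ℚ ε
1ᴰ = 1ℚ + 0ℚ ε

infix 8 ⊖_
⊖_ : Dual → Dual
⊖ (a + α ε) = (ℚ.- a) + (ℚ.- α) ε

⊕-assoc : Associative _⊕_
⊕-assoc (a + α ε) (b + β ε) (c + γ ε) = cong₂ _+_ε (ℚP.+-assoc a b c) (ℚP.+-assoc α β γ)

⊕-comm : Commutative _⊕_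
⊕-comm (a + α ε) (b + β ε) = cong₂ _+_ε (ℚP.+-comm a b) (ℚP.+-comm α β)

⊕-identityˡ : LeftIdentity 0ᴰ _⊕_
⊕-identityˡ (a + α ε) = cong₂ _+_ε (ℚP.+-identityˡ a) (ℚP.+-identityˡ α)

⊕-identityʳ : RightIdentity 0ᴰ _⊕_
⊕-identityʳ (a + α ε) = cong₂ _+_ε (ℚP.+-identityʳ a) (ℚP.+-identityʳ α)

⊖-inverseˡ : LeftInverse 0ᴰ ⊖_ _⊕_
⊖-inverseˡ (a + α ε) = cong₂ _+_ε (ℚP.+-inverseˡ a) (ℚP.+-inverseˡ α)

⊖-inverseʳ : RightInverse 0ᴰ ⊖_ _⊕_
⊖-inverseʳ (a + α ε) = cong₂ _+_ε (ℚP.+-inverseʳ a) (ℚP.+-inverseʳ α)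

module _ where
  open ℚ using (_+_; _*_)

  ⊗-assoc : Associative _⊗_
  ⊗-assoc (a + α ε) (b + β ε) (c + γ ε) = cong₂ _+_ε (ℚP.*-assoc a b c) (im-assoc a α b β c γ)
    where
    im-assoc : ∀ a α b β c γ →
      a * b * γ + (a * β + α * b) * c ≡ a * (b * γ + β * c) + α * (b * c)
    im-assoc = solve-∀ ℚ-solverRing

  ⊗-comm : Commutative _⊗_
  ⊗-comm (a + α ε) (b + β ε) = cong₂ _+_ε (ℚP.*-comm a b) (im-comm a α b β)
    where
    im-comm : ∀ a α b β → a * β + α * b ≡ b * α + β * a
    im-comm = solve-∀ ℚ-solverRing

  ⊗-identityˡ : LeftIdentity 1ᴰ _⊗_
  ⊗-identityˡ (a + α ε) = cong₂ _+_ε (ℚP.*-identityˡ a) (im-identityˡ a α)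
    where
    im-identityˡ : ∀ a α → 1ℚ * α + 0ℚ * a ≡ α
    im-identityˡ = solve-∀ ℚ-solverRing

  ⊗-identityʳ : RightIdentity 1ᴰ _⊗_
  ⊗-identityʳ (a + α ε) = cong₂ _+_ε (ℚP.*-identityʳ a) (im-identityʳ a α)
    where
    im-identityʳ : ∀ a α → a * 0ℚ + α * 1ℚ ≡ α
    im-identityʳ = solve-∀ ℚ-solverRing

  ⊗-distribˡ-⊕ : _⊗_ DistributesOverˡ _⊕_
  ⊗-distribˡ-⊕ (a + α ε) (b + β ε) (c + γ ε) =
    cong₂ _+_ε (ℚP.*-distribˡ-+ a b c) (im-distribˡ a α b β c γ)
    where
    im-distribˡ : ∀ a α b β c γ →
      a * (β + γ) + α * (b + c) ≡ a * β + α * b + (a * γ + α * c)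
    im-distribˡ = solve-∀ ℚ-solverRing

  ⊗-distribʳ-⊕ : _⊗_ DistributesOverʳ _⊕_
  ⊗-distribʳ-⊕ (a + α ε) (b + β ε) (c + γ ε) =
    cong₂ _+_ε (ℚP.*-distribʳ-+ a b c) (im-distribʳ a α b β c γ)
    where
    im-distribʳ : ∀ a α b β c γ →
      (b + c) * α + (β + γ) * a ≡ b * α + β * a + (c * α + γ * a)
    im-distribʳ = solve-∀ ℚ-solverRing

  A⊗[X÷A]≡X : ∀ X A .{{_ : ℚ.NonZero (re A)}} → A ⊗ divD X A ≡ X
  A⊗[X÷A]≡X (x + ξ ε) (a + α ε) = cong₂ _+_ε (q*[p÷q]≡p x a) (begin
    a * (((ξ * a ℚ.- α * x) ÷ a) ÷ a) + α * (x ÷ a)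
      ≡⟨ cong (_+ α * (x ÷ a)) (q*[p÷q]≡p ((ξ * a ℚ.- α * x) ÷ a) a) ⟩
    (ξ * a ℚ.- α * x) * ℚ.1/ a + α * (x * ℚ.1/ a)
      ≡⟨ cancel-αx ξ a α x (ℚ.1/ a) ⟩
    ξ * (a * ℚ.1/ a)
      ≡⟨ cong (ξ *_) (ℚP.*-inverseʳ a) ⟩
    ξ * 1ℚ
      ≡⟨ ℚP.*-identityʳ ξ ⟩
    ξ ∎)
    where
    open ≡-Reasoning
    cancel-αx : ∀ ξ a α x i → (ξ * a ℚ.- α * x) * i + α * (x * i) ≡ ξ * (a * i)
    cancel-αx = solve-∀ ℚ-solverRing

⊕-⊗-isCommutativeRing : IsCommutativeRing _⊕_ _⊗_ ⊖_ 0ᴰ 1ᴰ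
⊕-⊗-isCommutativeRing = record
  { isRing = record
    { +-isAbelianGroup = record
      { isGroup = record
        { isMonoid = record
          { isSemigroup = record { isMagma = isMagma _⊕_ ; assoc = ⊕-assoc }
          ; identity    = ⊕-identityˡ , ⊕-identityʳ
          }
        ; inverse = ⊖-inverseˡ , ⊖-inverseʳ
        ; ⁻¹-cong = cong ⊖_
        }
      ; comm = ⊕-comm
      }
    ; *-cong     = cong₂ _⊗_
    ; *-assoc    = ⊗-assoc
    ; *-identity = ⊗-identityˡ , ⊗-identityʳ
    ; distrib    = ⊗-distribˡ-⊕ , ⊗-distribʳ-⊕
    }
  ; *-comm = ⊗-comm
  }

⊕-⊗-commutativeRing : CommutativeRing 0ℓ 0ℓ
⊕-⊗-commutativeRing = record { isCommutativeRing = ⊕-⊗-isCommutativeRing }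

module 𝔻-Markov = MarkovEquation ⊕-⊗-commutativeRing

⊗-cancelˡ : ∀ A {U V} .{{_ : ℚ.NonZero (re A)}} → A ⊗ U ≡ A ⊗ V → U ≡ V
⊗-cancelˡ A {U} {V} = 𝔻-Markov.*-cancelˡ-invertible {A} {divD 1ᴰ A} {U} {V} (A⊗[X÷A]≡X 1ᴰ A)

A⊗U≡X⇒X÷A≡U : ∀ X A U .{{_ : ℚ.NonZero (re A)}} → A ⊗ U ≡ X → divD X A ≡ U
A⊗U≡X⇒X÷A≡U X A U e = ⊗-cancelˡ A (trans (A⊗[X÷A]≡X X A) (sym e))

open import Data.Integer using (_+_; _<_; _*_; _-_; -_; _≤_)

module ℤ-Markov = MarkovEquation ℤP.+-*-commutativeRing
module ℤ+ = CommSemigroupProperties ℤP.+-commutativeSemigroup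
module ℤ* = CommSemigroupProperties ℤP.*-commutativeSemigroup

markovCoefficient : ℤ → Dual
markovCoefficient σ = dualℤ (ℤ.+ 3) (- σ)

vieta-root-sum : ∀ σ A B C .{{_ : ℚ.NonZero (re A)}} → MarkovEq σ (A , B , C) →
                 A ⊕ divD (sq B ⊕ sq C) A ≡ markovCoefficient σ ⊗ B ⊗ C
vieta-root-sum σ A B C m = ⊗-cancelˡ A
  (𝔻-Markov.markov-root-sum (markovCoefficient σ) A (divD (sq B ⊕ sq C) A) B C (A⊗[X÷A]≡X _ A) m)

move-preserves-markov : ∀ σ {T U} → Move T U → MarkovEq σ T → MarkovEq σ U
move-preserves-markov σ (swap₁₂ A B C) = 𝔻-Markov.markov-swap₁₂ (markovCoefficient σ) A B C
move-preserves-markov σ (swap₂₃ A B C) = 𝔻-Markov.markov-swap₂₃ (markovCoefficient σ) A B C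
move-preserves-markov σ (vieta A B C nz) m = 𝔻-Markov.markov-otherRoot
  (markovCoefficient σ) A (divD (sq B ⊕ sq C) A) B C (vieta-root-sum σ A B C m) m
  where instance _ = ℚ.≢-nonZero nz

reach-preserves-markov : ∀ σ {T U} → Reach T U → MarkovEq σ T → MarkovEq σ U
reach-preserves-markov σ done        m = m
reach-preserves-markov σ (step mv r) m = reach-preserves-markov σ r (move-preserves-markov σ mv m)

fromℚᵘ-homo-+ : ∀ p q → ℚ.fromℚᵘ (p ℚᵘ.+ q) ≡ ℚ.fromℚᵘ p ℚ.+ ℚ.fromℚᵘ q
fromℚᵘ-homo-+ p q = ℚP.toℚᵘ-injective (ℚᵘP.≃-trans (ℚP.toℚᵘ-fromℚᵘ (p ℚᵘ.+ q))
  (ℚᵘP.≃-sym (ℚᵘP.≃-trans (ℚP.toℚᵘ-homo-+ (ℚ.fromℚᵘ p) (ℚ.fromℚᵘ q))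
                           (ℚᵘP.+-cong (ℚP.toℚᵘ-fromℚᵘ p) (ℚP.toℚᵘ-fromℚᵘ q)))))

fromℚᵘ-homo-* : ∀ p q → ℚ.fromℚᵘ (p ℚᵘ.* q) ≡ ℚ.fromℚᵘ p ℚ.* ℚ.fromℚᵘ q
fromℚᵘ-homo-* p q = ℚP.toℚᵘ-injective (ℚᵘP.≃-trans (ℚP.toℚᵘ-fromℚᵘ (p ℚᵘ.* q))
  (ℚᵘP.≃-sym (ℚᵘP.≃-trans (ℚP.toℚᵘ-homo-* (ℚ.fromℚᵘ p) (ℚ.fromℚᵘ q))
                           (ℚᵘP.*-cong (ℚP.toℚᵘ-fromℚᵘ p) (ℚP.toℚᵘ-fromℚᵘ q)))))

-- ι z is definitionally fromℚᵘ (mkℚᵘ z 0).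
ι-homo-+ : ∀ x y → ι (x + y) ≡ ι x ℚ.+ ι y
ι-homo-+ x y = trans (ℚP.fromℚᵘ-cong {mkℚᵘ (x + y) 0} {mkℚᵘ x 0 ℚᵘ.+ mkℚᵘ y 0} (*≡* cross))
                     (fromℚᵘ-homo-+ (mkℚᵘ x 0) (mkℚᵘ y 0))
  where
  cross : (x + y) * ℤ.+ 1 ≡ (x * ℤ.+ 1 + y * ℤ.+ 1) * ℤ.+ 1
  cross = ℤ-Solver.solve (x ∷ y ∷ [])

ι-homo-* : ∀ x y → ι (x * y) ≡ ι x ℚ.* ι y
ι-homo-* x y = fromℚᵘ-homo-* (mkℚᵘ x 0) (mkℚᵘ y 0)

ι-injective : ∀ {x y} → ι x ≡ ι y → x ≡ y
ι-injective {x} {y} e with ℚP.fromℚᵘ-injective {mkℚᵘ x 0} {mkℚᵘ y 0} e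
... | *≡* x*1≡y*1 = trans (sym (ℤP.*-identityʳ x)) (trans x*1≡y*1 (ℤP.*-identityʳ y))

dualℤ-homo-⊕ : ∀ a α b β → dualℤ a α ⊕ dualℤ b β ≡ dualℤ (a + b) (α + β)
dualℤ-homo-⊕ a α b β = sym (cong₂ _+_ε (ι-homo-+ a b) (ι-homo-+ α β))

dualℤ-homo-⊗ : ∀ a α b β → dualℤ a α ⊗ dualℤ b β ≡ dualℤ (a * b) (a * β + α * b)
dualℤ-homo-⊗ a α b β = sym (cong₂ _+_ε (ι-homo-* a b)
  (trans (ι-homo-+ (a * β) (α * b)) (cong₂ ℚ._+_ (ι-homo-* a β) (ι-homo-* α b))))

dualℤ-sumOfSquares : ∀ a α b β c γ →
  sq (dualℤ a α) ⊕ sq (dualℤ b β) ⊕ sq (dualℤ c γ) ≡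
  dualℤ (a * a + b * b + c * c) (a * α + α * a + (b * β + β * b) + (c * γ + γ * c))
dualℤ-sumOfSquares a α b β c γ = begin
  sq (dualℤ a α) ⊕ sq (dualℤ b β) ⊕ sq (dualℤ c γ)
    ≡⟨ cong₂ _⊕_ (cong₂ _⊕_ (dualℤ-homo-⊗ a α a α) (dualℤ-homo-⊗ b β b β)) (dualℤ-homo-⊗ c γ c γ) ⟩
  dualℤ (a * a) aα ⊕ dualℤ (b * b) bβ ⊕ dualℤ (c * c) cγ
    ≡⟨ cong (_⊕ dualℤ (c * c) cγ) (dualℤ-homo-⊕ (a * a) aα (b * b) bβ) ⟩
  dualℤ (a * a + b * b) (aα + bβ) ⊕ dualℤ (c * c) cγ
    ≡⟨ dualℤ-homo-⊕ (a * a + b * b) (aα + bβ) (c * c) cγ ⟩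
  dualℤ (a * a + b * b + c * c) (aα + bβ + cγ) ∎
  where
  open ≡-Reasoning
  aα = a * α + α * a
  bβ = b * β + β * b
  cγ = c * γ + γ * c

dualℤ-product₃ : ∀ k κ b β c γ →
  dualℤ k κ ⊗ dualℤ b β ⊗ dualℤ c γ ≡ dualℤ (k * b * c) (k * b * γ + (k * β + κ * b) * c)
dualℤ-product₃ k κ b β c γ =
  trans (cong (_⊗ dualℤ c γ) (dualℤ-homo-⊗ k κ b β)) (dualℤ-homo-⊗ (k * b) (k * β + κ * b) c γ)

dualℤ-product₄ : ∀ k κ a α b β c γ →
  dualℤ k κ ⊗ dualℤ a α ⊗ dualℤ b β ⊗ dualℤ c γ ≡
  dualℤ (k * a * b * c) (k * a * b * γ + (k * a * β + (k * α + κ * a) * b) * c)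
dualℤ-product₄ k κ a α b β c γ =
  trans (cong (λ X → X ⊗ dualℤ b β ⊗ dualℤ c γ) (dualℤ-homo-⊗ k κ a α))
        (dualℤ-product₃ (k * a) (k * α + κ * a) b β c γ)

initial-markov : ∀ α β γ → MarkovEq (α + β + γ) (initial α β γ)
initial-markov α β γ = trans (dualℤ-sumOfSquares one α one β one γ)
  (trans (cong (dualℤ (ℤ.+ 3)) (nilpotent α β γ))
         (sym (dualℤ-product₄ (ℤ.+ 3) (- (α + β + γ)) one α one β one γ)))
  where
  one = ℤ.+ 1
  nilpotent : ∀ α β γ →
    one * α + α * one + (one * β + β * one) + (one * γ + γ * one) ≡
    ℤ.+ 3 * one * one * γ + (ℤ.+ 3 * one * β + (ℤ.+ 3 * α + - (α + β + γ) * one) * one) * one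
  nilpotent = ℤ-Solver.solve-∀

integralTriple : ℤ → ℤ → ℤ → ℤ → ℤ → ℤ → Triple
integralTriple a α b β c γ = dualℤ a α , dualℤ b β , dualℤ c γ

markov-realPart : ∀ σ a α b β c γ → MarkovEq σ (integralTriple a α b β c γ) →
                  ℤ-Markov.Markov (ℤ.+ 3) a b c
markov-realPart σ a α b β c γ m = ι-injective (cong re
  (trans (sym (dualℤ-sumOfSquares a α b β c γ))
         (trans m (dualℤ-product₄ (ℤ.+ 3) (- σ) a α b β c γ))))

-- Components of A′ = (3 - σε)BC - A for A = a + αε, B = b + βε, C = c + γε.
otherRootRe : ℤ → ℤ → ℤ → ℤ
otherRootRe a b c = ℤ.+ 3 * b * c - a

otherRootIm : ℤ → ℤ → ℤ → ℤ → ℤ → ℤ → ℤ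
otherRootIm σ α b β c γ = ℤ.+ 3 * b * γ + (ℤ.+ 3 * β + - σ * b) * c - α

i+[j-i]≡j : ∀ i j → i + (j - i) ≡ j
i+[j-i]≡j = ℤ-Solver.solve-∀

otherRootRe-sum : ∀ a b c → a + otherRootRe a b c ≡ ℤ.+ 3 * b * c
otherRootRe-sum a b c = i+[j-i]≡j a (ℤ.+ 3 * b * c)

dualℤ-otherRoot-sum : ∀ σ a α b β c γ →
  dualℤ a α ⊕ dualℤ (otherRootRe a b c) (otherRootIm σ α b β c γ) ≡
  markovCoefficient σ ⊗ dualℤ b β ⊗ dualℤ c γ
dualℤ-otherRoot-sum σ a α b β c γ =
  trans (dualℤ-homo-⊕ a α (otherRootRe a b c) (otherRootIm σ α b β c γ))
  (trans (cong₂ dualℤ (otherRootRe-sum a b c) im-sum)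
         (sym (dualℤ-product₃ (ℤ.+ 3) (- σ) b β c γ)))
  where
  im-sum : α + otherRootIm σ α b β c γ ≡ ℤ.+ 3 * b * γ + (ℤ.+ 3 * β + - σ * b) * c
  im-sum = i+[j-i]≡j α _

pos*pos⇒pos : ∀ {i j} → ℤ.+ 0 < i → ℤ.+ 0 < j → ℤ.+ 0 < i * j
pos*pos⇒pos {i} 0<i 0<j =
  subst (_< i * _) (ℤP.*-zeroʳ i) (ℤP.*-monoˡ-<-pos i {{ℤ.positive 0<i}} 0<j)

nonNeg*nonNeg⇒nonNeg : ∀ {i j} → ℤ.+ 0 ≤ i → ℤ.+ 0 ≤ j → ℤ.+ 0 ≤ i * j
nonNeg*nonNeg⇒nonNeg {i} 0≤i 0≤j =
  subst (_≤ i * _) (ℤP.*-zeroʳ i) (ℤP.*-monoˡ-≤-nonNeg i {{ℤ.nonNegative 0≤i}} 0≤j)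

otherRoot-pos : ∀ {a a′ b c} → ℤ.+ 0 < a → ℤ.+ 0 < b → ℤ.+ 0 < c →
                a′ * a ≡ b * b + c * c → ℤ.+ 0 < a′
otherRoot-pos {a} {a′} pa pb pc p =
  ℤP.*-cancelʳ-<-nonNeg {i = ℤ.+ 0} {j = a′} a {{ℤ.nonNegative (ℤP.<⇒≤ pa)}}
    (subst (ℤ.+ 0 <_) (sym p) (ℤP.+-mono-< (pos*pos⇒pos pb pb) (pos*pos⇒pos pc pc)))

-- (a - b)(a′ - b) is the value at b of (x - a)(x - a′) = x² - 3bc x + b² + c²,
-- namely 2b² + c² - 3b²c = -(N + cb), which is negative.
otherRoot<middle : ∀ {a a′ b c} → ℤ.+ 0 < c → c ≤ b → ℤ.+ 2 ≤ b → b ≤ a →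
  a + a′ ≡ ℤ.+ 3 * b * c → a′ * a ≡ b * b + c * c → a′ < b
otherRoot<middle {a} {a′} {b} {c} pc c≤b 2≤b b≤a s p =
  ℤP.≰⇒> λ b≤a′ → ℤP.<-irrefl (sym vanishes) (positive b≤a′)
  where
  N = ℤ.+ 2 * b * b * (c - ℤ.+ 1) + c * (b * (b - ℤ.+ 2)) + c * (b - c)

  pb : ℤ.+ 0 < b
  pb = ℤP.<-≤-trans pc c≤b

  N≥0 : ℤ.+ 0 ≤ N
  N≥0 = ℤP.+-mono-≤ (ℤP.+-mono-≤
    (nonNeg*nonNeg⇒nonNeg
      (nonNeg*nonNeg⇒nonNeg (nonNeg*nonNeg⇒nonNeg (ℤ.+≤+ (z≤n {n = 2})) (ℤP.<⇒≤ pb)) (ℤP.<⇒≤ pb))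
      (ℤP.i≤j⇒0≤j-i (ℤP.i<j⇒suc[i]≤j pc)))
    (nonNeg*nonNeg⇒nonNeg (ℤP.<⇒≤ pc) (nonNeg*nonNeg⇒nonNeg (ℤP.<⇒≤ pb) (ℤP.i≤j⇒0≤j-i 2≤b))))
    (nonNeg*nonNeg⇒nonNeg (ℤP.<⇒≤ pc) (ℤP.i≤j⇒0≤j-i c≤b))

  positive : b ≤ a′ → ℤ.+ 0 < (a - b) * (a′ - b) + (N + c * b)
  positive b≤a′ = ℤP.+-mono-≤-<
    (nonNeg*nonNeg⇒nonNeg (ℤP.i≤j⇒0≤j-i b≤a) (ℤP.i≤j⇒0≤j-i b≤a′))
    (ℤP.+-mono-≤-< N≥0 (pos*pos⇒pos pc pb))

  vanishes : (a - b) * (a′ - b) + (N + c * b) ≡ ℤ.+ 0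
  vanishes = begin
    (a - b) * (a′ - b) + (N + c * b)
      ≡⟨ regroup a a′ b c ⟩
    (a′ * a - (b * b + c * c)) + b * (ℤ.+ 3 * b * c - (a + a′))
      ≡⟨ cong₂ (λ x y → x + b * y) (ℤP.i≡j⇒i-j≡0 p) (ℤP.i≡j⇒i-j≡0 (sym s)) ⟩
    ℤ.+ 0 + b * ℤ.+ 0
      ≡⟨ trans (ℤP.+-identityˡ (b * ℤ.+ 0)) (ℤP.*-zeroʳ b) ⟩
    ℤ.+ 0 ∎
    where
    open ≡-Reasoning
    regroup : ∀ a a′ b c →
      (a - b) * (a′ - b) +
        (ℤ.+ 2 * b * b * (c - ℤ.+ 1) + c * (b * (b - ℤ.+ 2)) + c * (b - c) + c * b) ≡
      (a′ * a - (b * b + c * c)) + b * (ℤ.+ 3 * b * c - (a + a′))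
    regroup = ℤ-Solver.solve-∀

otherRoot<max-sorted : ∀ {a a′ b c} → ℤ.+ 0 < c → c ≤ b → b ≤ a → ℤ.+ 2 ≤ a →
  a + a′ ≡ ℤ.+ 3 * b * c → a′ * a ≡ b * b + c * c → a′ < a
otherRoot<max-sorted {a} {a′} {b} {c} pc c≤b b≤a 2≤a s p with ℤ.+ 1 ℤP.≟ b
... | no 1≢b = ℤP.<-≤-trans (otherRoot<middle pc c≤b 2≤b b≤a s p) b≤a
  where 2≤b = ℤP.i<j⇒suc[i]≤j (ℤP.≤∧≢⇒< (ℤP.i<j⇒suc[i]≤j (ℤP.<-≤-trans pc c≤b)) 1≢b)
... | yes refl with ℤP.≤-antisym c≤b (ℤP.i<j⇒suc[i]≤j pc)
...   | refl = ℤP.≰⇒> λ a≤a′ → ℤP.<-irrefl refl (begin-strict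
  ℤ.+ 3  <⟨ ℤP.suc[i]≤j⇒i<j (ℤP.+-mono-≤ 2≤a 2≤a) ⟩
  a + a  ≤⟨ ℤP.+-monoʳ-≤ a a≤a′ ⟩
  a + a′ ≡⟨ s ⟩
  ℤ.+ 3  ∎)
  where open ℤP.≤-Reasoning

otherRoot<max : ∀ {a a′ b c} → ℤ.+ 0 < b → ℤ.+ 0 < c → b ≤ a → c ≤ a → ℤ.+ 2 ≤ a →
  a + a′ ≡ ℤ.+ 3 * b * c → a′ * a ≡ b * b + c * c → a′ < a
otherRoot<max {a} {a′} {b} {c} pb pc b≤a c≤a 2≤a s p with ℤP.≤-total c b
... | inj₁ c≤b = otherRoot<max-sorted pc c≤b b≤a 2≤a s p
... | inj₂ b≤c = otherRoot<max-sorted pb b≤c c≤a 2≤a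
  (trans s (ℤ*.xy∙z≈xz∙y (ℤ.+ 3) b c)) (trans p (ℤP.+-comm (b * b) (c * c)))

Obtainable : Triple → Set
Obtainable T = ∃[ α′ ] ∃[ β′ ] ∃[ γ′ ] Reach (initial α′ β′ γ′) T

_▻_ : ∀ {T U V} → Reach T U → Move U V → Reach T V
done       ▻ mv = step mv done
step mv′ r ▻ mv = step mv′ (r ▻ mv)

obtainable-move : ∀ {T U} → Obtainable T → Move T U → Obtainable U
obtainable-move (α′ , β′ , γ′ , r) mv = α′ , β′ , γ′ , r ▻ mv

Descent : ℤ → ℕ → Set
Descent σ n = ∀ a α b β c γ → a + b + c ≤ ℤ.+ n →
  ℤ.+ 0 < a → ℤ.+ 0 < b → ℤ.+ 0 < c → MarkovEq σ (integralTriple a α b β c γ) →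
  Obtainable (integralTriple a α b β c γ)

sum-pos : ∀ {a b c} → ℤ.+ 0 < a → ℤ.+ 0 < b → ℤ.+ 0 < c → ℤ.+ 0 < a + b + c
sum-pos pa pb pc = ℤP.+-mono-< (ℤP.+-mono-< pa pb) pc

max-cases : ∀ a b c → (b ≤ a × c ≤ a) ⊎ (a ≤ b × c ≤ b) ⊎ (a ≤ c × b ≤ c)
max-cases a b c with ℤP.≤-total b a | ℤP.≤-total c a | ℤP.≤-total c b
... | inj₁ b≤a | inj₁ c≤a | _        = inj₁ (b≤a , c≤a)
... | inj₂ a≤b | _        | inj₁ c≤b = inj₂ (inj₁ (a≤b , c≤b))
... | inj₂ a≤b | _        | inj₂ b≤c = inj₂ (inj₂ (ℤP.≤-trans a≤b b≤c , b≤c))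
... | inj₁ b≤a | inj₂ a≤c | _        = inj₂ (inj₂ (a≤c , ℤP.≤-trans b≤a a≤c))

-- Replacing the largest entry A by its other root A′ strictly lowers a + b + c,
-- and the Vieta move from (A′, B, C) gives back (A, B, C).
descend-from-max : ∀ σ n → Descent σ n → ∀ a α b β c γ → a + b + c ≤ ℤ.+ suc n →
  ℤ.+ 0 < a → ℤ.+ 0 < b → ℤ.+ 0 < c → b ≤ a → c ≤ a →
  MarkovEq σ (integralTriple a α b β c γ) → Obtainable (integralTriple a α b β c γ)
descend-from-max σ n descent a α b β c γ s pa pb pc b≤a c≤a m with ℤ.+ 1 ℤP.≟ a
... | yes refl with ℤP.≤-antisym b≤a (ℤP.i<j⇒suc[i]≤j pb) | ℤP.≤-antisym c≤a (ℤP.i<j⇒suc[i]≤j pc)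
...   | refl | refl = α , β , γ , done
descend-from-max σ n descent a α b β c γ s pa pb pc b≤a c≤a m | no 1≢a =
  subst (λ X → Obtainable (X , B , C)) (A⊗U≡X⇒X÷A≡U (sq B ⊕ sq C) A′ (dualℤ a α) product)
        (obtainable-move otherRoot-obtainable (vieta A′ B C re-A′≢0))
  where
  B = dualℤ b β
  C = dualℤ c γ
  a′ = otherRootRe a b c
  A′ = dualℤ a′ (otherRootIm σ α b β c γ)

  sum : dualℤ a α ⊕ A′ ≡ markovCoefficient σ ⊗ B ⊗ C
  sum = dualℤ-otherRoot-sum σ a α b β c γ

  product : A′ ⊗ dualℤ a α ≡ sq B ⊕ sq C
  product = 𝔻-Markov.markov-otherRoot-product
    (markovCoefficient σ) (dualℤ a α) A′ B C sum m

  a′*a≡b²+c² : a′ * a ≡ b * b + c * c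
  a′*a≡b²+c² = ℤ-Markov.markov-otherRoot-product (ℤ.+ 3) a a′ b c
    (otherRootRe-sum a b c) (markov-realPart σ a α b β c γ m)

  0<a′ : ℤ.+ 0 < a′
  0<a′ = otherRoot-pos pa pb pc a′*a≡b²+c²

  a′<a : a′ < a
  a′<a = otherRoot<max pb pc b≤a c≤a
    (ℤP.i<j⇒suc[i]≤j (ℤP.≤∧≢⇒< (ℤP.i<j⇒suc[i]≤j pa) 1≢a)) (otherRootRe-sum a b c) a′*a≡b²+c²

  otherRoot-obtainable : Obtainable (A′ , B , C)
  otherRoot-obtainable = descent a′ (otherRootIm σ α b β c γ) b β c γ
    (ℤP.i<j⇒i≤pred[j] (ℤP.<-≤-trans (ℤP.+-monoˡ-< c (ℤP.+-monoˡ-< b a′<a)) s)) 0<a′ pb pc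
    (𝔻-Markov.markov-otherRoot (markovCoefficient σ) (dualℤ a α) A′ B C sum m)

  re-A′≢0 : re A′ ≢ 0ℚ
  re-A′≢0 e = ℤP.<⇒≢ 0<a′ (sym (ι-injective e))

  instance _ = ℚ.≢-nonZero re-A′≢0

descend : ∀ σ n → Descent σ n
descend σ zero _ _ _ _ _ _ s pa pb pc m = ⊥-elim (ℤP.<⇒≱ (sum-pos pa pb pc) s)
descend σ (suc n) a α b β c γ s pa pb pc m with max-cases a b c
... | inj₁ (b≤a , c≤a) = descend-from-max σ n (descend σ n) a α b β c γ s pa pb pc b≤a c≤a m
... | inj₂ (inj₁ (a≤b , c≤b)) = obtainable-move
  (descend-from-max σ n (descend σ n) b β a α c γ
    (subst (_≤ ℤ.+ suc n) (ℤ+.xy∙z≈yx∙z a b c) s) pb pa pc a≤b c≤b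
    (move-preserves-markov σ (swap₁₂ (dualℤ a α) (dualℤ b β) (dualℤ c γ)) m))
  (swap₁₂ _ _ _)
... | inj₂ (inj₂ (a≤c , b≤c)) = obtainable-move (obtainable-move
  (descend-from-max σ n (descend σ n) c γ a α b β
    (subst (_≤ ℤ.+ suc n) (ℤ+.xy∙z≈zx∙y a b c) s) pc pa pb a≤c b≤c
    (move-preserves-markov σ (swap₁₂ (dualℤ a α) (dualℤ c γ) (dualℤ b β))
      (move-preserves-markov σ (swap₂₃ (dualℤ a α) (dualℤ b β) (dualℤ c γ)) m)))
  (swap₁₂ _ _ _)) (swap₂₃ _ _ _)

proposition3p1 : (α₁ β₁ γ₁ : ℤ) →
    ((T : Triple) → Reach (initial α₁ β₁ γ₁) T → MarkovEq (α₁ + β₁ + γ₁) T)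
    ×
    ((a α b β c γ : ℤ) → ℤ.+ 0 < a → ℤ.+ 0 < b → ℤ.+ 0 < c →
      MarkovEq (α₁ + β₁ + γ₁) (dualℤ a α , dualℤ b β , dualℤ c γ) →
      ∃[ α' ] ∃[ β' ] ∃[ γ' ]
        Reach (initial α' β' γ') (dualℤ a α , dualℤ b β , dualℤ c γ))
proposition3p1 α₁ β₁ γ₁ =
  (λ T r → reach-preserves-markov σ r (initial-markov α₁ β₁ γ₁)) ,
  (λ a α b β c γ pa pb pc m → descend σ ℤ.∣ a + b + c ∣ a α b β c γ
     (ℤP.≤-reflexive (sym (ℤP.0≤i⇒+∣i∣≡i (ℤP.<⇒≤ (sum-pos pa pb pc))))) pa pb pc m)
  where
  σ = α₁ + β₁ + γ₁
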